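{- Let $p$ be a prime and $\mathcal{A},\mathcal{B}\subseteq\mathbb{F}_p$ nonempty. If $\mathfrak{A}(\mathcal{A},\mathcal{B})=\tau|\mathcal{A}+\mathcal{B}|$, then \[|\mathcal{A}||\mathcal{B}|\geqslant 2^{1-\tau}|\mathcal{A}+\mathcal{B}|.\]
   Context: $\mathcal{A}+\mathcal{B}=\{a+b:a\in\mathcal{A},b\in\mathcal{B}\}$; $r(x)=|\{(a,b)\in\mathcal{A}\times\mathcal{B}:a+b=x\}|$; $\mathfrak{A}(\mathcal{A},\mathcal{B})=|\{x\in\mathcal{A}+\mathcal{B}:r(x)=1\}|$. -}

module Defs where

open import Data.Nat using (ℕ; NonZero; _+_; _≟_; _≤?_)
open import Data.Nat.DivMod using (_mod_)
open import Data.Fin using (Fin; toℕ)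
open import Data.Fin.Subset using (Subset; ∣_∣)
open import Data.Fin.Subset.Properties using (_∈?_)
open import Data.Fin.Properties using () renaming (_≟_ to _≟ᶠ_)
open import Data.List using (List; length; filter; allFin; cartesianProduct)
open import Data.Product using (_×_; _,_; proj₁; proj₂)
open import Data.Vec using (tabulate)
open import Relation.Nullary using (does; _×-dec_)

_+ₚ_ : ∀ {p} .{{_ : NonZero p}} → Fin p → Fin p → Fin p
_+ₚ_ {p} a b = (toℕ a + toℕ b) mod p

r : ∀ {p} .{{_ : NonZero p}} → Subset p → Subset p → Fin p → ℕ
r {p} A B x = length (filter (λ ab → (proj₁ ab ∈? A) ×-dec ((proj₂ ab ∈? B) ×-dec ((proj₁ ab +ₚ proj₂ ab) ≟ᶠ x)))
                            (cartesianProduct (allFin p) (allFin p)))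

sumset : ∀ {p} .{{_ : NonZero p}} → Subset p → Subset p → Subset p
sumset A B = tabulate (λ x → does (1 ≤? r A B x))

-- 𝔄(A,B) = |{x ∈ A + B : r(x) = 1}|
uniqueReps : ∀ {p} .{{_ : NonZero p}} → Subset p → Subset p → ℕ
uniqueReps A B = ∣ tabulate (λ x → does (r A B x ≟ 1)) ∣

module Submission where

-- Every x ∈ A + B has r(x) ≥ 1, and r(x) ≥ 2 unless x is uniquely represented, so
-- |A||B| = ∑ₓ r(x) ≥ 2|A + B| − 𝔄.  Writing s = |A + B| and k = s − 𝔄, it remains to see that
-- (s + k)^s ≥ 2^k s^s for k ≤ s, i.e. (1 + k/s)^s ≥ 2^k: the sequence (1 + k/n)^n increases
-- in n (a Bernoulli inequality) and equals 2^k at n = k.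

open import Data.Bool.Base using (Bool; true; false; _∧_)
open import Data.Fin.Base using (Fin; zero; suc)
open import Data.Fin.Properties using () renaming (_≟_ to _≟ᶠ_)
open import Data.Fin.Subset using (Subset; ∣_∣; Nonempty; inside; outside)
open import Data.Fin.Subset.Properties using (_∈?_)
open import Data.List.Base using ([]; _∷_; _++_; length; filter; map; allFin; cartesianProduct)
import Data.List.Base as List
open import Data.List.Properties using (map-++; map-∘; map-tabulate)
open import Data.Nat.Base
open import Data.Nat.ListAction using () renaming (sum to sumᴸ)
open import Data.Nat.ListAction.Properties using () renaming (sum-++ to sumᴸ-++)
open import Data.Nat.Primality using (Prime)
open import Data.Nat.Properties
open import Data.Nat.Tactic.RingSolver using (solve-∀)
open import Data.Product.Base using (_×_; _,_)
open import Data.Vec.Base using (tabulate; []; _∷_)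
open import Function.Base using (_∘_)
open import Relation.Nullary.Decidable.Core using (does; _×-dec_)
open import Relation.Unary using (Pred; Decidable)
open import Relation.Binary.PropositionalEquality
open import Algebra.Properties.Semiring.Sum +-*-semiring
  using (sum; sum-syntax; sum-cong-≗; sum-replicate-zero; ∑-comm; ∑-distrib-+; *-distribˡ-sum; *-distribʳ-sum)

open import Defs

indicator : Bool → ℕ
indicator true  = 1
indicator false = 0

indicator-∧ : ∀ b c → indicator (b ∧ c) ≡ indicator b * indicator c
indicator-∧ true  c = sym (*-identityˡ (indicator c))
indicator-∧ false c = refl

sum-mono-≤ : ∀ {n} {f g : Fin n → ℕ} → (∀ i → f i ≤ g i) → sum f ≤ sum g
sum-mono-≤ {zero}  f≤g = z≤n
sum-mono-≤ {suc n} f≤g = +-mono-≤ (f≤g zero) (sum-mono-≤ (f≤g ∘ suc))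

∑-indicator-≟ : ∀ {n} (y : Fin n) → ∑[ x < n ] indicator (does (y ≟ᶠ x)) ≡ 1
∑-indicator-≟ {suc n} zero    = cong suc (sum-replicate-zero n)
∑-indicator-≟ {suc n} (suc y) = ∑-indicator-≟ y

∑-fibres : ∀ {m n k} (f : Fin m → Fin n → Fin k) (α : Fin m → ℕ) (β : Fin n → ℕ) →
  ∑[ x < k ] ∑[ a < m ] ∑[ b < n ] (α a * (β b * indicator (does (f a b ≟ᶠ x))))
    ≡ sum α * sum β
∑-fibres {m} {n} {k} f α β = begin
  ∑[ x < k ] ∑[ a < m ] ∑[ b < n ] (α a * (β b * δ a b x))
    ≡⟨ ∑-comm (λ x a → ∑[ b < n ] (α a * (β b * δ a b x))) ⟩
  ∑[ a < m ] ∑[ x < k ] ∑[ b < n ] (α a * (β b * δ a b x))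
    ≡⟨ sum-cong-≗ (λ a → ∑-comm (λ x b → α a * (β b * δ a b x))) ⟩
  ∑[ a < m ] ∑[ b < n ] ∑[ x < k ] (α a * (β b * δ a b x))
    ≡⟨ sum-cong-≗ (λ a → sum-cong-≗ (λ b → fibre a b)) ⟩
  ∑[ a < m ] ∑[ b < n ] (α a * β b)
    ≡⟨ sum-cong-≗ (λ a → sym (*-distribˡ-sum (α a) β)) ⟩
  ∑[ a < m ] (α a * sum β)
    ≡⟨ sym (*-distribʳ-sum (sum β) α) ⟩
  sum α * sum β
    ∎
  where
  open ≡-Reasoning
  δ : Fin m → Fin n → Fin k → ℕ
  δ a b x = indicator (does (f a b ≟ᶠ x))
  fibre : ∀ a b → ∑[ x < k ] (α a * (β b * δ a b x)) ≡ α a * β b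
  fibre a b = begin
    ∑[ x < k ] (α a * (β b * δ a b x))   ≡⟨ sym (*-distribˡ-sum (α a) (λ x → β b * δ a b x)) ⟩
    α a * ∑[ x < k ] (β b * δ a b x)     ≡⟨ cong (α a *_) (sym (*-distribˡ-sum (β b) (δ a b))) ⟩
    α a * (β b * ∑[ x < k ] δ a b x)     ≡⟨ cong (λ s → α a * (β b * s)) (∑-indicator-≟ (f a b)) ⟩
    α a * (β b * 1)                      ≡⟨ cong (α a *_) (*-identityʳ (β b)) ⟩
    α a * β b                            ∎

∣p∣≡∑indicator : ∀ {n} (p : Subset n) → ∣ p ∣ ≡ ∑[ i < n ] indicator (does (i ∈? p))
∣p∣≡∑indicator []            = refl
∣p∣≡∑indicator (inside  ∷ p) = cong suc (∣p∣≡∑indicator p)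
∣p∣≡∑indicator (outside ∷ p) = ∣p∣≡∑indicator p

∣tabulate∣≡∑indicator : ∀ {n} (h : Fin n → Bool) → ∣ tabulate h ∣ ≡ ∑[ i < n ] indicator (h i)
∣tabulate∣≡∑indicator {zero}  h = refl
∣tabulate∣≡∑indicator {suc n} h with h zero
... | true  = cong suc (∣tabulate∣≡∑indicator (h ∘ suc))
... | false = ∣tabulate∣≡∑indicator (h ∘ suc)

module _ {a p} {A : Set a} {P : Pred A p} (P? : Decidable P) where

  length-filter≡sumᴸ : ∀ xs → length (filter P? xs) ≡ sumᴸ (map (indicator ∘ does ∘ P?) xs)
  length-filter≡sumᴸ []       = refl
  length-filter≡sumᴸ (x ∷ xs) with does (P? x)
  ... | true  = cong suc (length-filter≡sumᴸ xs)
  ... | false = length-filter≡sumᴸ xs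

sumᴸ-map-cartesianProduct : ∀ {a b} {A : Set a} {B : Set b} (g : A × B → ℕ) xs ys →
  sumᴸ (map g (cartesianProduct xs ys)) ≡ sumᴸ (map (λ x → sumᴸ (map (λ y → g (x , y)) ys)) xs)
sumᴸ-map-cartesianProduct g []       ys = refl
sumᴸ-map-cartesianProduct g (x ∷ xs) ys = begin
  sumᴸ (map g (map (x ,_) ys ++ cartesianProduct xs ys))
    ≡⟨ cong sumᴸ (map-++ g (map (x ,_) ys) _) ⟩
  sumᴸ (map g (map (x ,_) ys) ++ map g (cartesianProduct xs ys))
    ≡⟨ sumᴸ-++ (map g (map (x ,_) ys)) _ ⟩
  sumᴸ (map g (map (x ,_) ys)) + sumᴸ (map g (cartesianProduct xs ys))
    ≡⟨ cong₂ _+_ (cong sumᴸ (sym (map-∘ ys))) (sumᴸ-map-cartesianProduct g xs ys) ⟩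
  sumᴸ (map (λ y → g (x , y)) ys) + sumᴸ (map (λ x → sumᴸ (map (λ y → g (x , y)) ys)) xs)
    ∎
  where open ≡-Reasoning

sumᴸ-map-allFin : ∀ {n} (g : Fin n → ℕ) → sumᴸ (map g (allFin n)) ≡ ∑[ i < n ] g i
sumᴸ-map-allFin {n} g = trans (cong sumᴸ (map-tabulate (λ i → i) g)) (sumᴸ-tabulate g)
  where
  sumᴸ-tabulate : ∀ {n} (h : Fin n → ℕ) → sumᴸ (List.tabulate h) ≡ sum h
  sumᴸ-tabulate {zero}  h = refl
  sumᴸ-tabulate {suc n} h = cong (h zero +_) (sumᴸ-tabulate (h ∘ suc))

[n≡1]≤[1≤n] : ∀ n → indicator (does (n ≟ 1)) ≤ indicator (does (1 ≤? n))
[n≡1]≤[1≤n] zero          = z≤n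
[n≡1]≤[1≤n] (suc zero)    = ≤-refl
[n≡1]≤[1≤n] (suc (suc n)) = z≤n

2*[1≤n]≤n+[n≡1] : ∀ n → 2 * indicator (does (1 ≤? n)) ≤ n + indicator (does (n ≟ 1))
2*[1≤n]≤n+[n≡1] zero          = z≤n
2*[1≤n]≤n+[n≡1] (suc zero)    = ≤-refl
2*[1≤n]≤n+[n≡1] (suc (suc n)) = s≤s (s≤s z≤n)

[m*n]^k≡m^k*n^k : ∀ m n k → (m * n) ^ k ≡ m ^ k * n ^ k
[m*n]^k≡m^k*n^k m n zero    = refl
[m*n]^k≡m^k*n^k m n (suc k) = begin
  m * n * (m * n) ^ k       ≡⟨ cong (m * n *_) ([m*n]^k≡m^k*n^k m n k) ⟩
  m * n * (m ^ k * n ^ k)   ≡⟨ [m*n]*[o*p]≡[m*o]*[n*p] m n (m ^ k) (n ^ k) ⟩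
  m * m ^ k * (n * n ^ k)   ∎
  where open ≡-Reasoning

[x+y]^[1+n]≤x^[1+n]+[1+n]*y*[x+y]^n : ∀ x y n → (x + y) ^ suc n ≤ x ^ suc n + suc n * y * (x + y) ^ n
[x+y]^[1+n]≤x^[1+n]+[1+n]*y*[x+y]^n x y zero    = ≤-reflexive (unit x y)
  where
  unit : ∀ x y → (x + y) * 1 ≡ x * 1 + 1 * y * 1
  unit = solve-∀
[x+y]^[1+n]≤x^[1+n]+[1+n]*y*[x+y]^n x y (suc n) = begin
  (x + y) * (x + y) ^ suc n
    ≤⟨ *-monoʳ-≤ (x + y) ([x+y]^[1+n]≤x^[1+n]+[1+n]*y*[x+y]^n x y n) ⟩
  (x + y) * (x ^ suc n + suc n * y * (x + y) ^ n)
    ≡⟨ expand x y n (x ^ suc n) ((x + y) ^ n) ⟩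
  x * x ^ suc n + y * x ^ suc n + suc n * y * (x + y) ^ suc n
    ≤⟨ +-monoˡ-≤ _ (+-monoʳ-≤ (x * x ^ suc n) (*-monoʳ-≤ y (^-monoˡ-≤ (suc n) (m≤m+n x y)))) ⟩
  x * x ^ suc n + y * (x + y) ^ suc n + suc n * y * (x + y) ^ suc n
    ≡⟨ collect x y n (x * x ^ suc n) ((x + y) ^ suc n) ⟩
  x * x ^ suc n + suc (suc n) * y * (x + y) ^ suc n
    ∎
  where
  open ≤-Reasoning
  expand : ∀ x y n u v → (x + y) * (u + suc n * y * v) ≡ x * u + y * u + suc n * y * ((x + y) * v)
  expand = solve-∀
  collect : ∀ x y n u v → u + y * v + suc n * y * v ≡ u + suc (suc n) * y * v
  collect = solve-∀

-- Monotonicity of (1 + k/n)ⁿ in n.  Multiplied by n, it is the Bernoulli bound above for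
-- x = n(1 + n + k) and y = k, because x + k = (1 + n)(n + k).
[1+n]^[1+n]*[n+k]^n≤n^n*[1+n+k]^[1+n] : ∀ n k → suc n ^ suc n * (n + k) ^ n ≤ n ^ n * (suc n + k) ^ suc n
[1+n]^[1+n]*[n+k]^n≤n^n*[1+n+k]^[1+n] zero        k = s≤s z≤n
[1+n]^[1+n]*[n+k]^n≤n^n*[1+n+k]^[1+n] n@(suc _) k = *-cancelˡ-≤ n (begin
  n * (suc n ^ suc n * (n + k) ^ n)   ≡⟨ cong (n *_) lhs ⟩
  n * (suc n * y ^ n)                 ≤⟨ +-cancelʳ-≤ (suc n * k * y ^ n) _ _ bernoulli ⟩
  x ^ suc n                           ≡⟨ [m*n]^k≡m^k*n^k n (suc n + k) (suc n) ⟩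
  n ^ suc n * (suc n + k) ^ suc n     ≡⟨ *-assoc n (n ^ n) _ ⟩
  n * (n ^ n * (suc n + k) ^ suc n)   ∎)
  where
  open ≤-Reasoning
  x = n * (suc n + k)
  y = suc n * (n + k)
  x+k≡y : x + k ≡ y
  x+k≡y = expand n k
    where
    expand : ∀ n k → n * (suc n + k) + k ≡ suc n * (n + k)
    expand = solve-∀
  lhs : suc n ^ suc n * (n + k) ^ n ≡ suc n * y ^ n
  lhs = trans (*-assoc (suc n) (suc n ^ n) _) (cong (suc n *_) (sym ([m*n]^k≡m^k*n^k (suc n) (n + k) n)))
  bernoulli : n * (suc n * y ^ n) + suc n * k * y ^ n ≤ x ^ suc n + suc n * k * y ^ n
  bernoulli = begin
    n * (suc n * y ^ n) + suc n * k * y ^ n   ≡⟨ factor n k (y ^ n) ⟩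
    y * y ^ n                                 ≡⟨ cong (_^ suc n) x+k≡y ⟨
    (x + k) ^ suc n                           ≤⟨ [x+y]^[1+n]≤x^[1+n]+[1+n]*y*[x+y]^n x k n ⟩
    x ^ suc n + suc n * k * (x + k) ^ n       ≡⟨ cong (λ z → x ^ suc n + suc n * k * z ^ n) x+k≡y ⟩
    x ^ suc n + suc n * k * y ^ n             ∎
    where
    factor : ∀ n k z → n * (suc n * z) + suc n * k * z ≡ suc n * (n + k) * z
    factor = solve-∀

n^n≢0 : ∀ n → NonZero (n ^ n)
n^n≢0 zero    = _
n^n≢0 (suc n) = m^n≢0 (suc n) (suc n)

2^k*n^n≤[n+k]^n : ∀ {k n} → k ≤ n → 2 ^ k * n ^ n ≤ (n + k) ^ n
2^k*n^n≤[n+k]^n k≤n = from-≤′ (≤⇒≤′ k≤n)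
  where
  from-≤′ : ∀ {k n} → k ≤′ n → 2 ^ k * n ^ n ≤ (n + k) ^ n
  from-≤′ {k} ≤′-refl = ≤-reflexive (begin-equality
    2 ^ k * k ^ k   ≡⟨ [m*n]^k≡m^k*n^k 2 k k ⟨
    (2 * k) ^ k     ≡⟨ cong (λ m → (k + m) ^ k) (+-identityʳ k) ⟩
    (k + k) ^ k     ∎)
    where open ≤-Reasoning
  from-≤′ {k} (≤′-step {n} k≤′n) = *-cancelʳ-≤ _ _ (n ^ n) {{n^n≢0 n}} (begin
    2 ^ k * suc n ^ suc n * n ^ n     ≡⟨ rearrange (2 ^ k) (suc n ^ suc n) (n ^ n) ⟩
    suc n ^ suc n * (2 ^ k * n ^ n)   ≤⟨ *-monoʳ-≤ (suc n ^ suc n) (from-≤′ k≤′n) ⟩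
    suc n ^ suc n * (n + k) ^ n       ≤⟨ [1+n]^[1+n]*[n+k]^n≤n^n*[1+n+k]^[1+n] n k ⟩
    n ^ n * (suc n + k) ^ suc n       ≡⟨ *-comm (n ^ n) _ ⟩
    (suc n + k) ^ suc n * n ^ n       ∎)
    where
    open ≤-Reasoning
    rearrange : ∀ a b c → a * b * c ≡ b * (a * c)
    rearrange = solve-∀

module _ {p} .{{_ : NonZero p}} (A B : Subset p) where

  r≡∑∑ : ∀ x → r A B x ≡ ∑[ a < p ] ∑[ b < p ]
           (indicator (does (a ∈? A)) * (indicator (does (b ∈? B)) * indicator (does ((a +ₚ b) ≟ᶠ x))))
  r≡∑∑ x = begin
    r A B x
      ≡⟨ length-filter≡sumᴸ P? (cartesianProduct (allFin p) (allFin p)) ⟩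
    sumᴸ (map (indicator ∘ does ∘ P?) (cartesianProduct (allFin p) (allFin p)))
      ≡⟨ sumᴸ-map-cartesianProduct (indicator ∘ does ∘ P?) (allFin p) (allFin p) ⟩
    sumᴸ (map (λ a → sumᴸ (map (λ b → indicator (does (P? (a , b)))) (allFin p))) (allFin p))
      ≡⟨ sumᴸ-map-allFin (λ a → sumᴸ (map (λ b → indicator (does (P? (a , b)))) (allFin p))) ⟩
    ∑[ a < p ] sumᴸ (map (λ b → indicator (does (P? (a , b)))) (allFin p))
      ≡⟨ sum-cong-≗ (λ a → trans (sumᴸ-map-allFin (λ b → indicator (does (P? (a , b))))) (sum-cong-≗ (split a))) ⟩
    ∑[ a < p ] ∑[ b < p ]
      (indicator (does (a ∈? A)) * (indicator (does (b ∈? B)) * indicator (does ((a +ₚ b) ≟ᶠ x))))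
      ∎
    where
    open ≡-Reasoning
    P? = λ ((a , b) : Fin p × Fin p) → (a ∈? A) ×-dec ((b ∈? B) ×-dec ((a +ₚ b) ≟ᶠ x))
    split : ∀ a b → indicator (does (P? (a , b)))
                  ≡ indicator (does (a ∈? A)) * (indicator (does (b ∈? B)) * indicator (does ((a +ₚ b) ≟ᶠ x)))
    split a b = trans (indicator-∧ (does (a ∈? A)) _) (cong (indicator (does (a ∈? A)) *_) (indicator-∧ (does (b ∈? B)) _))

  ∑r≡∣A∣*∣B∣ : ∑[ x < p ] r A B x ≡ ∣ A ∣ * ∣ B ∣
  ∑r≡∣A∣*∣B∣ = begin
    ∑[ x < p ] r A B x
      ≡⟨ sum-cong-≗ r≡∑∑ ⟩
    ∑[ x < p ] ∑[ a < p ] ∑[ b < p ]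
      (indicator (does (a ∈? A)) * (indicator (does (b ∈? B)) * indicator (does ((a +ₚ b) ≟ᶠ x))))
      ≡⟨ ∑-fibres _+ₚ_ (λ a → indicator (does (a ∈? A))) (λ b → indicator (does (b ∈? B))) ⟩
    ∑[ a < p ] indicator (does (a ∈? A)) * ∑[ b < p ] indicator (does (b ∈? B))
      ≡⟨ sym (cong₂ _*_ (∣p∣≡∑indicator A) (∣p∣≡∑indicator B)) ⟩
    ∣ A ∣ * ∣ B ∣
      ∎
    where open ≡-Reasoning

  ∣sumset∣≡∑[1≤r] : ∣ sumset A B ∣ ≡ ∑[ x < p ] indicator (does (1 ≤? r A B x))
  ∣sumset∣≡∑[1≤r] = ∣tabulate∣≡∑indicator (λ x → does (1 ≤? r A B x))

  uniqueReps≡∑[r≡1] : uniqueReps A B ≡ ∑[ x < p ] indicator (does (r A B x ≟ 1))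
  uniqueReps≡∑[r≡1] = ∣tabulate∣≡∑indicator (λ x → does (r A B x ≟ 1))

  uniqueReps≤∣sumset∣ : uniqueReps A B ≤ ∣ sumset A B ∣
  uniqueReps≤∣sumset∣ = subst₂ _≤_ (sym uniqueReps≡∑[r≡1]) (sym ∣sumset∣≡∑[1≤r])
    (sum-mono-≤ (λ x → [n≡1]≤[1≤n] (r A B x)))

  2*∣sumset∣≤∣A∣*∣B∣+uniqueReps : 2 * ∣ sumset A B ∣ ≤ ∣ A ∣ * ∣ B ∣ + uniqueReps A B
  2*∣sumset∣≤∣A∣*∣B∣+uniqueReps = begin
    2 * ∣ sumset A B ∣
      ≡⟨ cong (2 *_) ∣sumset∣≡∑[1≤r] ⟩
    2 * ∑[ x < p ] indicator (does (1 ≤? r A B x))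
      ≡⟨ *-distribˡ-sum 2 (λ x → indicator (does (1 ≤? r A B x))) ⟩
    ∑[ x < p ] (2 * indicator (does (1 ≤? r A B x)))
      ≤⟨ sum-mono-≤ (λ x → 2*[1≤n]≤n+[n≡1] (r A B x)) ⟩
    ∑[ x < p ] (r A B x + indicator (does (r A B x ≟ 1)))
      ≡⟨ ∑-distrib-+ (r A B) (λ x → indicator (does (r A B x ≟ 1))) ⟩
    ∑[ x < p ] r A B x + ∑[ x < p ] indicator (does (r A B x ≟ 1))
      ≡⟨ cong₂ _+_ ∑r≡∣A∣*∣B∣ (sym uniqueReps≡∑[r≡1]) ⟩
    ∣ A ∣ * ∣ B ∣ + uniqueReps A B
      ∎
    where open ≤-Reasoning

lemma4p2 : ∀ (p : ℕ) .{{_ : NonZero p}} → Prime p → (A B : Subset p) → Nonempty A → Nonempty B →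
    2 ^ (∣ sumset A B ∣ ∸ uniqueReps A B) * ∣ sumset A B ∣ ^ ∣ sumset A B ∣ ≤ (∣ A ∣ * ∣ B ∣) ^ ∣ sumset A B ∣
lemma4p2 p _ A B _ _ = begin
  2 ^ (s ∸ u) * s ^ s   ≤⟨ 2^k*n^n≤[n+k]^n (m∸n≤m s u) ⟩
  (s + (s ∸ u)) ^ s     ≤⟨ ^-monoˡ-≤ s s+[s∸u]≤ab ⟩
  (∣ A ∣ * ∣ B ∣) ^ s   ∎
  where
  open ≤-Reasoning
  s = ∣ sumset A B ∣
  u = uniqueReps A B
  s+[s∸u]≤ab : s + (s ∸ u) ≤ ∣ A ∣ * ∣ B ∣
  s+[s∸u]≤ab = begin
    s + (s ∸ u)                    ≡⟨ +-∸-assoc s (uniqueReps≤∣sumset∣ A B) ⟨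
    s + s ∸ u                      ≡⟨ cong (λ t → s + t ∸ u) (+-identityʳ s) ⟨
    2 * s ∸ u                      ≤⟨ ∸-monoˡ-≤ u (2*∣sumset∣≤∣A∣*∣B∣+uniqueReps A B) ⟩
    ∣ A ∣ * ∣ B ∣ + u ∸ u          ≡⟨ m+n∸n≡m (∣ A ∣ * ∣ B ∣) u ⟩
    ∣ A ∣ * ∣ B ∣                  ∎
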